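{- Let $\Gamma\le S_m$ and let $H$ be a complete $m$-edge-coloured graph. Suppose that the colours of all edges of $H$ lie in a single orbit $O$ of the action of the commutator subgroup $[\Gamma,\Gamma]$ on $[m]$. Then for every $j\in O$, $H$ is $\Gamma$-switch equivalent to the complete graph on $V(H)$ all of whose edges have colour $j$.
   Context: An $m$-edge-coloured complete graph is a complete graph with each edge coloured from $[m]=\{1,\dots,m\}$. For $\Gamma\le S_m$, $\pi\in\Gamma$ and a vertex $v$, switching at $v$ with $\pi$ recolours every edge incident with $v$ of colour $i$ to colour $\pi(i)$, leaving other edges unchanged. Two $m$-edge-coloured complete graphs on the same vertex set are $\Gamma$-switch equivalent if one is obtained from the other by a finite sequence of such switches (vertices and group elements may repeat). $[\Gamma,\Gamma]$ is the subgroup generated by all commutators $\beta^{ -1}\alpha^{ -1}\beta\alpha$, $\alpha,\beta\in\Gamma$. -}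

module Defs where

open import Data.Nat using (ℕ)
open import Data.Fin using (Fin)
open import Data.Fin.Permutation using (Permutation′; _⟨$⟩ʳ_; _≈_; id; flip; _∘ₚ_)
open import Data.Product using (Σ; _×_; _,_)
open import Data.Fin using (_≟_)
open import Relation.Nullary using (¬_; yes; no)
open import Relation.Binary.PropositionalEquality using (_≡_; _≢_)

record IsSubgroup (m : ℕ) (Γ : Permutation′ m → Set) : Set where
  field
    resp     : ∀ {π ρ} → π ≈ ρ → Γ π → Γ ρ
    has-id   : Γ id
    ∘-closed : ∀ {π ρ} → Γ π → Γ ρ → Γ (π ∘ₚ ρ)
    ⁻¹-closed : ∀ {π} → Γ π → Γ (flip π)

-- The commutator β⁻¹α⁻¹βα.
commutator : ∀ {m} → Permutation′ m → Permutation′ m → Permutation′ m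
commutator α β = α ∘ₚ (β ∘ₚ (flip α ∘ₚ flip β))

data InCommutator {m : ℕ} (Γ : Permutation′ m → Set) : Permutation′ m → Set where
  comm  : ∀ {α β} → Γ α → Γ β → InCommutator Γ (commutator α β)
  unit  : InCommutator Γ id
  mul   : ∀ {π ρ} → InCommutator Γ π → InCommutator Γ ρ → InCommutator Γ (π ∘ₚ ρ)
  inv   : ∀ {π} → InCommutator Γ π → InCommutator Γ (flip π)
  resp  : ∀ {π ρ} → π ≈ ρ → InCommutator Γ π → InCommutator Γ ρ

InOrbit : ∀ {m} → (Permutation′ m → Set) → Fin m → Fin m → Set
InOrbit Γ i j = Σ (Permutation′ _) λ σ → InCommutator Γ σ × (σ ⟨$⟩ʳ i ≡ j)

-- An m-edge-coloured complete graph on vertex set Fin n: the colour of the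
-- edge {u,v} (u ≠ v) is H u v. Values on the diagonal are irrelevant.
Colouring : ℕ → ℕ → Set
Colouring n m = Fin n → Fin n → Fin m

SymmetricColouring : ∀ {n m} → Colouring n m → Set
SymmetricColouring H = ∀ u v → H u v ≡ H v u

_≈E_ : ∀ {n m} → Colouring n m → Colouring n m → Set
H ≈E K = ∀ u v → u ≢ v → H u v ≡ K u v

switch : ∀ {n m} → Fin n → Permutation′ m → Colouring n m → Colouring n m
switch v π H a b with a ≟ v | b ≟ v
... | yes _ | _     = π ⟨$⟩ʳ H a b
... | no _  | yes _ = π ⟨$⟩ʳ H a b
... | no _  | no _  = H a b

data SwitchEquiv {n m : ℕ} (Γ : Permutation′ m → Set) : Colouring n m → Colouring n m → Set where
  done : ∀ {H K} → H ≈E K → SwitchEquiv Γ H K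
  step : ∀ {H K} (v : Fin n) (π : Permutation′ m) → Γ π →
         SwitchEquiv Γ (switch v π H) K → SwitchEquiv Γ H K

mono : ∀ {n m} → Fin m → Colouring n m
mono j _ _ = j

-- A switch at v with π applies π to the colours of the edges incident with v. Switching
-- at u with α, at v with β, at u with α⁻¹ and at v with β⁻¹ therefore cancels on every
-- edge except uv, which is recoloured by the commutator of α and β. Since switch
-- equivalence is an equivalence relation, the permutations that can be applied to the
-- single edge uv form a group, which hence contains [Γ,Γ]. If c and j lie in one
-- [Γ,Γ]-orbit, some σ ∈ [Γ,Γ] maps c to j, so each edge can be recoloured to j in turn.
module Submission where

open import Defs
open import Data.Bool using (Bool; true; false; _∧_; _∨_; if_then_else_)
open import Data.Bool.Properties using (∨-comm; ∨-zeroʳ; ∧-conicalˡ; ∧-conicalʳ)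
open import Data.Empty using (⊥-elim)
open import Data.Fin using (Fin; _≟_)
open import Data.Fin.Permutation
  using (Permutation′; _⟨$⟩ʳ_; _≈_; id; flip; _∘ₚ_; inverseˡ; inverseʳ)
open import Data.List using (List; []; _∷_; allFin; cartesianProduct; filter)
open import Data.List.Membership.Propositional using (_∈_)
open import Data.List.Membership.Propositional.Properties
  using (∈-allFin; ∈-cartesianProduct⁺; ∈-filter⁺)
open import Data.List.Relation.Unary.All using (All; []; _∷_)
open import Data.List.Relation.Unary.All.Properties using (all-filter)
open import Data.List.Relation.Unary.Any using (here; there)
open import Data.Nat using (ℕ)
open import Data.Product using (_×_; _,_; uncurry)
open import Data.Sum using (_⊎_; inj₁; inj₂)
open import Relation.Binary.PropositionalEquality
  using (_≡_; _≢_; refl; sym; trans; cong; cong₂; module ≡-Reasoning)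
open import Relation.Nullary using (¬?; does; yes; no)
open import Relation.Nullary.Decidable using (dec-true)

applyIf : ∀ {m} → Bool → Permutation′ m → Fin m → Fin m
applyIf true  π c = π ⟨$⟩ʳ c
applyIf false π c = c

module _ {m : ℕ} where

  applyIf-id : ∀ x (c : Fin m) → applyIf x id c ≡ c
  applyIf-id true  c = refl
  applyIf-id false c = refl

  applyIf-∘ₚ : ∀ x (π ρ : Permutation′ m) c →
               applyIf x ρ (applyIf x π c) ≡ applyIf x (π ∘ₚ ρ) c
  applyIf-∘ₚ true  π ρ c = refl
  applyIf-∘ₚ false π ρ c = refl

  applyIf-inverseˡ : ∀ x (π : Permutation′ m) c → applyIf x (flip π) (applyIf x π c) ≡ c
  applyIf-inverseˡ true  π c = inverseˡ π
  applyIf-inverseˡ false π c = refl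

  applyIf-inverseʳ : ∀ x (π : Permutation′ m) c → applyIf x π (applyIf x (flip π) c) ≡ c
  applyIf-inverseʳ true  π c = inverseʳ π
  applyIf-inverseʳ false π c = refl

  applyIf-cong : ∀ x {π ρ : Permutation′ m} → π ≈ ρ → ∀ c → applyIf x π c ≡ applyIf x ρ c
  applyIf-cong true  π≈ρ c = π≈ρ c
  applyIf-cong false π≈ρ c = refl

  applyIf-commutator : ∀ x y (α β : Permutation′ m) c →
    applyIf y (flip β) (applyIf x (flip α) (applyIf y β (applyIf x α c)))
      ≡ applyIf (x ∧ y) (commutator α β) c
  applyIf-commutator true  true  α β c = refl
  applyIf-commutator true  false α β c = inverseˡ α
  applyIf-commutator false true  α β c = inverseˡ β
  applyIf-commutator false false α β c = refl

Mask : ℕ → Set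
Mask n = Fin n → Fin n → Bool

recolour : ∀ {n m} → Mask n → Permutation′ m → Colouring n m → Colouring n m
recolour M π H a b = applyIf (M a b) π (H a b)

incident : ∀ {n} → Fin n → Mask n
incident v a b = does (a ≟ v) ∨ does (b ≟ v)

-- For u ≢ v and a ≢ b this holds exactly when {a, b} = {u, v}.
edgeMask : ∀ {n} → Fin n → Fin n → Mask n
edgeMask u v a b = incident u a b ∧ incident v a b

setEdge : ∀ {n m} → Fin n → Fin n → Fin m → Colouring n m → Colouring n m
setEdge u v j K a b = if edgeMask u v a b then j else K a b

module _ {n : ℕ} where

  incident-sym : ∀ (v a b : Fin n) → incident v a b ≡ incident v b a
  incident-sym v a b = ∨-comm (does (a ≟ v)) (does (b ≟ v))

  edgeMask-sym : ∀ (u v a b : Fin n) → edgeMask u v a b ≡ edgeMask u v b a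
  edgeMask-sym u v a b = cong₂ _∧_ (incident-sym u a b) (incident-sym v a b)

  incident-sound : ∀ {v a b : Fin n} → incident v a b ≡ true → a ≡ v ⊎ b ≡ v
  incident-sound {v} {a} {b} _ with a ≟ v | b ≟ v
  ... | yes a≡v | _       = inj₁ a≡v
  ... | no _    | yes b≡v = inj₂ b≡v

  edgeMask-sound : ∀ {u v a b : Fin n} → u ≢ v → edgeMask u v a b ≡ true →
                   (a ≡ u × b ≡ v) ⊎ (a ≡ v × b ≡ u)
  edgeMask-sound {u} {v} {a} {b} u≢v mask
    with incident-sound {u} {a} {b} (∧-conicalˡ _ _ mask)
       | incident-sound {v} {a} {b} (∧-conicalʳ _ _ mask)
  ... | inj₁ refl | inj₁ refl = ⊥-elim (u≢v refl)
  ... | inj₁ a≡u  | inj₂ b≡v  = inj₁ (a≡u , b≡v)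
  ... | inj₂ b≡u  | inj₁ a≡v  = inj₂ (a≡v , b≡u)
  ... | inj₂ refl | inj₂ refl = ⊥-elim (u≢v refl)

  edgeMask-self : ∀ (a b : Fin n) → edgeMask a b a b ≡ true
  edgeMask-self a b rewrite dec-true (a ≟ a) refl | dec-true (b ≟ b) refl
    = ∨-zeroʳ (does (a ≟ b))

  switch≗recolour : ∀ {m} v (π : Permutation′ m) (H : Colouring n m) a b →
                    switch v π H a b ≡ recolour (incident v) π H a b
  switch≗recolour v π H a b with a ≟ v | b ≟ v
  ... | yes _ | _     = refl
  ... | no _  | yes _ = refl
  ... | no _  | no _  = refl

setEdge-symmetric : ∀ {n m} (u v : Fin n) (j : Fin m) {K : Colouring n m} →
                    SymmetricColouring K → SymmetricColouring (setEdge u v j K)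
setEdge-symmetric u v j {K} K-sym a b
  rewrite edgeMask-sym u v a b | K-sym a b = refl

fillEdges : ∀ {n m} → Fin m → List (Fin n × Fin n) → Colouring n m → Colouring n m
fillEdges j []             K = K
fillEdges j ((u , v) ∷ L) K = setEdge u v j (fillEdges j L K)

fillEdges-covers : ∀ {n m} (j : Fin m) L (K : Colouring n m) {a b} →
                   (a , b) ∈ L → fillEdges j L K a b ≡ j
fillEdges-covers j ((a , b) ∷ L) K (here refl) rewrite edgeMask-self a b = refl
fillEdges-covers j ((u , v) ∷ L) K {a} {b} (there ab∈L) with edgeMask u v a b
... | true  = refl
... | false = fillEdges-covers j L K ab∈L

module _ {n m : ℕ} {Γ : Permutation′ m → Set} (Γ-subgroup : IsSubgroup m Γ) where
  open IsSubgroup Γ-subgroup using (⁻¹-closed)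

  _∼_ : Colouring n m → Colouring n m → Set
  _∼_ = SwitchEquiv Γ

  ∼-respˡ : ∀ {H H′ K} → H ≈E H′ → H′ ∼ K → H ∼ K
  ∼-respˡ H≈H′ (done H′≈K) = done λ a b a≢b → trans (H≈H′ a b a≢b) (H′≈K a b a≢b)
  ∼-respˡ {H} {H′} H≈H′ (step v π γπ r) = step v π γπ (∼-respˡ switch-cong r)
    where
    switch-cong : switch v π H ≈E switch v π H′
    switch-cong a b a≢b = begin
      switch v π H a b                    ≡⟨ switch≗recolour v π H a b ⟩
      applyIf (incident v a b) π (H a b)  ≡⟨ cong (applyIf (incident v a b) π) (H≈H′ a b a≢b) ⟩
      applyIf (incident v a b) π (H′ a b) ≡⟨ switch≗recolour v π H′ a b ⟨
      switch v π H′ a b                   ∎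
      where open ≡-Reasoning

  ∼-trans : ∀ {H K L} → H ∼ K → K ∼ L → H ∼ L
  ∼-trans (done H≈K)       K∼L = ∼-respˡ H≈K K∼L
  ∼-trans (step v π γπ r) K∼L = step v π γπ (∼-trans r K∼L)

  ∼-recolourIncident : ∀ {π} → Γ π → ∀ v H → H ∼ recolour (incident v) π H
  ∼-recolourIncident γπ v H = step v _ γπ (done λ a b _ → switch≗recolour v _ H a b)

  ∼-sym : ∀ {H K} → H ∼ K → K ∼ H
  ∼-sym (done H≈K) = done λ a b a≢b → sym (H≈K a b a≢b)
  ∼-sym {H} (step v π γπ r) = ∼-trans (∼-sym r) (step v (flip π) (⁻¹-closed γπ) (done undo))
    where
    undo : switch v (flip π) (switch v π H) ≈E H
    undo a b _ = begin
      switch v (flip π) (switch v π H) a b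
        ≡⟨ switch≗recolour v (flip π) _ a b ⟩
      applyIf (incident v a b) (flip π) (switch v π H a b)
        ≡⟨ cong (applyIf (incident v a b) (flip π)) (switch≗recolour v π H a b) ⟩
      applyIf (incident v a b) (flip π) (applyIf (incident v a b) π (H a b))
        ≡⟨ applyIf-inverseˡ (incident v a b) π (H a b) ⟩
      H a b
        ∎
      where open ≡-Reasoning

  ∼-recolourCommutator : ∀ u v {α β} → Γ α → Γ β → ∀ H →
                         H ∼ recolour (edgeMask u v) (commutator α β) H
  ∼-recolourCommutator u v {α} {β} γα γβ H =
    ∼-trans (∼-recolourIncident γα u _) (
    ∼-trans (∼-recolourIncident γβ v _) (
    ∼-trans (∼-recolourIncident (⁻¹-closed γα) u _) (
    ∼-trans (∼-recolourIncident (⁻¹-closed γβ) v _) (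
    done λ a b _ → applyIf-commutator (incident u a b) (incident v a b) α β (H a b)))))

  -- {σ ∣ ∀ H → H ∼ recolour M σ H} is a subgroup of S_m.
  ∼-recolourCommutatorSubgroup :
    ∀ (M : Mask n) → (∀ {α β} → Γ α → Γ β → ∀ H → H ∼ recolour M (commutator α β) H) →
    ∀ {σ} → InCommutator Γ σ → ∀ H → H ∼ recolour M σ H
  ∼-recolourCommutatorSubgroup M viaCommutators = go
    where
    go : ∀ {σ} → InCommutator Γ σ → ∀ H → H ∼ recolour M σ H
    go (comm γα γβ) H = viaCommutators γα γβ H
    go unit H = done λ a b _ → sym (applyIf-id (M a b) (H a b))
    go (mul {π} {ρ} σπ σρ) H =
      ∼-trans (go σπ H) (∼-trans (go σρ _) (done λ a b _ → applyIf-∘ₚ (M a b) π ρ (H a b)))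
    go (inv {π} σπ) H =
      ∼-respˡ (λ a b _ → sym (applyIf-inverseʳ (M a b) π (H a b))) (∼-sym (go σπ _))
    go (resp π≈ρ σπ) H =
      ∼-trans (go σπ H) (done λ a b _ → applyIf-cong (M a b) π≈ρ (H a b))

  OrbitColoured : Fin m → Colouring n m → Set
  OrbitColoured o K = ∀ a b → a ≢ b → InOrbit Γ o (K a b)

  inOrbit-between : ∀ {o c j} → InOrbit Γ o c → InOrbit Γ o j → InOrbit Γ c j
  inOrbit-between {o} (ρ , σρ , ρo≡c) (τ , στ , τo≡j) = flip ρ ∘ₚ τ , mul (inv σρ) στ , maps
    where
    open ≡-Reasoning
    maps : τ ⟨$⟩ʳ (flip ρ ⟨$⟩ʳ _) ≡ _
    maps = begin
      τ ⟨$⟩ʳ (flip ρ ⟨$⟩ʳ _)            ≡⟨ cong (λ c → τ ⟨$⟩ʳ (flip ρ ⟨$⟩ʳ c)) ρo≡c ⟨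
      τ ⟨$⟩ʳ (flip ρ ⟨$⟩ʳ (ρ ⟨$⟩ʳ o))   ≡⟨ cong (τ ⟨$⟩ʳ_) (inverseˡ ρ) ⟩
      τ ⟨$⟩ʳ o                          ≡⟨ τo≡j ⟩
      _                                 ∎

  setEdge-orbitColoured : ∀ u v {o j K} → InOrbit Γ o j → OrbitColoured o K →
                          OrbitColoured o (setEdge u v j K)
  setEdge-orbitColoured u v j∈o K-orbit a b a≢b with edgeMask u v a b
  ... | true  = j∈o
  ... | false = K-orbit a b a≢b

  ∼-setEdge : ∀ {u v o j K} → u ≢ v → InOrbit Γ o j → SymmetricColouring K →
              OrbitColoured o K → K ∼ setEdge u v j K
  ∼-setEdge {u} {v} {j = j} {K} u≢v j∈o K-sym K-orbit
    with inOrbit-between (K-orbit u v u≢v) j∈o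
  ... | σ , σ∈ , σKuv≡j =
    ∼-trans (∼-recolourCommutatorSubgroup (edgeMask u v) (∼-recolourCommutator u v) σ∈ K)
            (done agree)
    where
    colour-on-edge : ∀ {a b} → (a ≡ u × b ≡ v) ⊎ (a ≡ v × b ≡ u) → K a b ≡ K u v
    colour-on-edge (inj₁ (refl , refl)) = refl
    colour-on-edge (inj₂ (refl , refl)) = K-sym v u

    agree : recolour (edgeMask u v) σ K ≈E setEdge u v j K
    agree a b _ with edgeMask u v a b in mask
    ... | true  = trans (cong (σ ⟨$⟩ʳ_) (colour-on-edge (edgeMask-sound u≢v mask))) σKuv≡j
    ... | false = refl

  fillEdges-invariant : ∀ {o j} L {K} → InOrbit Γ o j →
    SymmetricColouring K → OrbitColoured o K →
    SymmetricColouring (fillEdges j L K) × OrbitColoured o (fillEdges j L K)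
  fillEdges-invariant []             j∈o K-sym K-orbit = K-sym , K-orbit
  fillEdges-invariant ((u , v) ∷ L) j∈o K-sym K-orbit
    with fillEdges-invariant L j∈o K-sym K-orbit
  ... | sym′ , orbit′ = setEdge-symmetric u v _ sym′ , setEdge-orbitColoured u v j∈o orbit′

  ∼-fillEdges : ∀ {o j L K} → All (uncurry _≢_) L → InOrbit Γ o j →
                SymmetricColouring K → OrbitColoured o K → K ∼ fillEdges j L K
  ∼-fillEdges [] j∈o K-sym K-orbit = done λ _ _ _ → refl
  ∼-fillEdges {L = (u , v) ∷ L} (u≢v ∷ distinct) j∈o K-sym K-orbit
    with fillEdges-invariant L j∈o K-sym K-orbit
  ... | sym′ , orbit′ =
    ∼-trans (∼-fillEdges distinct j∈o K-sym K-orbit) (∼-setEdge u≢v j∈o sym′ orbit′)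

distinctPairs : (n : ℕ) → List (Fin n × Fin n)
distinctPairs n = filter (λ (a , b) → ¬? (a ≟ b)) (cartesianProduct (allFin n) (allFin n))

distinctPairs-distinct : ∀ n → All (uncurry _≢_) (distinctPairs n)
distinctPairs-distinct n = all-filter _ (cartesianProduct (allFin n) (allFin n))

∈-distinctPairs : ∀ {n} {a b : Fin n} → a ≢ b → (a , b) ∈ distinctPairs n
∈-distinctPairs a≢b =
  ∈-filter⁺ (λ (a , b) → ¬? (a ≟ b)) (∈-cartesianProduct⁺ (∈-allFin _) (∈-allFin _)) a≢b

lemma6 : (m : ℕ) (Γ : Permutation′ m → Set) → IsSubgroup m Γ →
         (n : ℕ) (H : Colouring n m) → SymmetricColouring H →
         (o : Fin m) →
         (∀ u v → u ≢ v → InOrbit Γ o (H u v)) →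
         (j : Fin m) → InOrbit Γ o j →
         SwitchEquiv Γ H (mono j)
lemma6 m Γ Γ-subgroup n H H-sym o H-orbit j j∈o =
  ∼-trans Γ-subgroup
    (∼-fillEdges Γ-subgroup (distinctPairs-distinct n) j∈o H-sym H-orbit)
    (done λ a b a≢b → fillEdges-covers j (distinctPairs n) H (∈-distinctPairs a≢b))
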